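{- Fix $q\in[6]=\{1,\dots,6\}$ and a colouring of the edges of the complete graph on $[6]\setminus\{q\}$ in white and black such that each colour class forms a $5$-cycle (a mystic pentagon). For each white edge $A$ there is a unique black edge $B$ disjoint from it; with $e$ the remaining element of $[6]\setminus\{q\}$, the triples $\{A,B,\{e,q\}\}$ form five synthemes. For a $3$-subset $T\subseteq[6]$ let $T'=T$ if $q\in T$ and $T'=[6]\setminus T$ otherwise, let $d_T=T'\setminus\{q\}$, let $d'$ be the other edge of $[6]\setminus\{q\}$ in the syntheme containing $d_T$, and set $D(T)=\{q\}\cup d'$. Define $\rho(T)=D(T)$ if either ($q\in T$ and $d_T$ is white) or ($q\notin T$ and $d_T$ is black), and $\rho(T)=[6]\setminus D(T)$ otherwise. Then for all $3$-subsets $T,U\subseteq[6]$, $$|T\cap U|=1\iff|\rho(T)\cap\rho(U)|=2,$$ i.e. $d(T,U)=2\iff d(\rho(T),\rho(U))=1$ where $d(T,U)=3-|T\cap U|$. Thus $\rho$ is an isomorphism from the graph $J(6,3,1)$ (adjacency $|T\cap U|=1$) onto the Johnson graph $J(6,3)$ (adjacency $|T\cap U|=2$) on the $3$-subsets of $[6]$.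
   Context: $J(6,3)$ denotes the Johnson graph on the $20$ three-element subsets of $[6]$, two being adjacent when they share exactly two elements. -}

module Defs where

open import Data.Bool using (Bool; true; false; not; if_then_else_; _∧_)
open import Data.Bool.Properties using () renaming (_≟_ to _≟ᵇ_)
open import Data.Nat using (ℕ; zero; suc; _≡ᵇ_)
open import Data.Fin using (Fin; zero; suc)
open import Data.Fin.Subset using (Subset; ⁅_⁆; ∁; _∩_; _∪_; ∣_∣; ⊥)
open import Data.Fin.Subset.Properties using (_∈?_)
open import Data.Vec using (Vec; []; _∷_)
open import Data.Vec.Properties using (≡-dec)
open import Data.List using (List; []; _∷_; map; _++_)
open import Data.Product using (Σ; ∃; _×_; _,_)
open import Data.Sum using (_⊎_)
open import Function using (Injective; _⇔_)
open import Relation.Nullary using (¬_; does)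
open import Relation.Binary.PropositionalEquality using (_≡_; _≢_)

allSubsets : (n : ℕ) → List (Subset n)
allSubsets zero    = [] ∷ []
allSubsets (suc n) = map (true ∷_) (allSubsets n) ++ map (false ∷_) (allSubsets n)

next5 : Fin 5 → Fin 5
next5 zero                          = suc zero
next5 (suc zero)                    = suc (suc zero)
next5 (suc (suc zero))              = suc (suc (suc zero))
next5 (suc (suc (suc zero)))        = suc (suc (suc (suc zero)))
next5 (suc (suc (suc (suc zero))))  = zero

edge : Fin 6 → Fin 6 → Subset 6
edge a b = ⁅ a ⁆ ∪ ⁅ b ⁆

-- A colouring of the edges of the complete graph on [6] \ {q} is given by
-- W : Subset 6 → Bool (true = white, false = black), of which only the values
-- on the 2-subsets of [6] \ {q} are relevant.
-- "The colour class c forms a 5-cycle": there is a cyclic ordering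
-- v 0, ..., v 4 of the five vertices of [6] \ {q} such that an edge {a , b}
-- has colour c iff it joins two cyclically consecutive vertices v i, v (i+1).
ColourClassIs5Cycle : Fin 6 → (Subset 6 → Bool) → Bool → Set
ColourClassIs5Cycle q W c =
  Σ (Fin 5 → Fin 6) λ v →
    Injective _≡_ _≡_ v ×
    (∀ i → v i ≢ q) ×
    (∀ a b → a ≢ q → b ≢ q → a ≢ b →
      (W (edge a b) ≡ c ⇔
        (∃ λ i → (a ≡ v i × b ≡ v (next5 i)) ⊎ (b ≡ v i × a ≡ v (next5 i)))))

firstSuch : (Subset 6 → Bool) → List (Subset 6) → Subset 6
firstSuch p []       = ⊥
firstSuch p (s ∷ ss) = if p s then s else firstSuch p ss

-- For an edge d of [6] \ {q}, the other edge d' of [6] \ {q} in the syntheme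
-- containing d: the (unique) edge of [6] \ {q} disjoint from d and of the
-- opposite colour.
otherEdge : Fin 6 → (Subset 6 → Bool) → Subset 6 → Subset 6
otherEdge q W d = firstSuch test (allSubsets 6)
  where
  test : Subset 6 → Bool
  test s = (∣ s ∣ ≡ᵇ 2) ∧ not (does (q ∈? s))
         ∧ does (≡-dec _≟ᵇ_ (s ∩ d) ⊥) ∧ not (does (W s ≟ᵇ W d))

T′ : Fin 6 → Subset 6 → Subset 6
T′ q T = if does (q ∈? T) then T else ∁ T

dT : Fin 6 → Subset 6 → Subset 6
dT q T = T′ q T ∩ ∁ ⁅ q ⁆

D : Fin 6 → (Subset 6 → Bool) → Subset 6 → Subset 6
D q W T = ⁅ q ⁆ ∪ otherEdge q W (dT q T)

-- ρ(T) = D(T) iff (q ∈ T and d_T white) or (q ∉ T and d_T black),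
-- i.e. iff the colour of d_T (true = white) equals [q ∈ T].
ρ : Fin 6 → (Subset 6 → Bool) → Subset 6 → Subset 6
ρ q W T = if does (W (dT q T) ≟ᵇ does (q ∈? T)) then D q W T else ∁ (D q W T)

{-# OPTIONS --safe #-}

-- ρ reads the colouring only on edges of [6] ∖ {q} (d_T is such an edge, and the search for d′
-- inspects no others), and there the white class is the 5-cycle of the hypothesis. So ρ is
-- determined by q and a cyclic ordering of [6] ∖ {q}, that is, an injective t : Fin 5 → Fin 5 read
-- through punchIn q. Rotating or reflecting the ordering does not change the cycle, and every
-- ordering has such an image with t 0 = 0 and t 1 < t 4; for these 12 orderings and the six choices
-- of q the isomorphism property is checked by evaluation on all pairs of triples.

module Submission where

open import Defs
open import Data.Bool using (Bool; true; false; not; if_then_else_; _∧_)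
open import Data.Bool.Properties using (⇔→≡; T-≡) renaming (_≟_ to _≟ᵇ_)
open import Data.Fin using (Fin; zero; suc; _<_; punchIn; punchOut; #_)
open import Data.Fin.Properties using (all?; any?; _<?_; punchIn-punchOut) renaming (_≟_ to _≟ᶠ_)
open import Data.Fin.Subset using (Subset; _∩_; ∣_∣; _∈_; _∉_; ⁅_⁆; ∁; _∪_; ⊥)
open import Data.Fin.Subset.Properties using (_∈?_; x∈⁅x⁆; x∈⁅y⁆⇒x≡y; x∈p∪q⁻; x∈p∪q⁺; ∪-comm)
open import Data.List using (List; []; _∷_; map; filter; iterate; _++_)
open import Data.List.Membership.Propositional using () renaming (_∈_ to _∈ₗ_)
open import Data.List.Membership.Propositional.Properties using (∈-map⁺; ∈-filter⁺; ∈-++⁺ˡ; ∈-++⁺ʳ)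
open import Data.List.Relation.Unary.All as All using (All)
open import Data.List.Relation.Unary.Any as Any using (Any; here)
open import Data.Nat as ℕ using (_≡ᵇ_) renaming (_≟_ to _≟ℕ_)
open import Data.Nat.Properties using (≡ᵇ⇒≡)
open import Data.Product using (∃; ∃₂; _×_; _,_; proj₁; proj₂; <_,_>; uncurry)
open import Data.Sum using (_⊎_; inj₁; inj₂)
open import Data.Vec using (Vec; []; _∷_; lookup; tabulate)
open import Data.Vec.Properties using (≡-dec; lookup∘tabulate)
open import Function using (_∘_; id; _⇔_; mk⇔; Equivalence; Injective)
open import Function.Construct.Composition using (_⇔-∘_)
open import Function.Construct.Symmetry using (⇔-sym)
open import Relation.Binary.Definitions using (DecidableEquality)
open import Relation.Binary.PropositionalEquality
  using (_≡_; _≢_; refl; sym; trans; cong; cong₂; subst; subst₂; _≗_; module ≡-Reasoning)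
open import Relation.Nullary using (Dec; yes; no; does; contradiction)
open import Relation.Nullary.Decidable using (map′; _×-dec_; _→-dec_; ¬?; from-yes; dec-true; does-⇔)
open import Relation.Unary using (Decidable)

open Equivalence using (to; from)

infix 4 _≟ₛ_
_≟ₛ_ : ∀ {n} → DecidableEquality (Subset n)
_≟ₛ_ = ≡-dec _≟ᵇ_

_⇔?_ : ∀ {A B : Set} → Dec A → Dec B → Dec (A ⇔ B)
a? ⇔? b? = map′ (uncurry mk⇔) (λ a⇔b → to a⇔b , from a⇔b) ((a? →-dec b?) ×-dec (b? →-dec a?))

∀-Bool? : {P : Bool → Set} → Decidable P → Dec (∀ x → P x)
∀-Bool? P? = map′ (λ { (p , _) true → p ; (_ , p) false → p }) (λ p → p true , p false)
                  (P? true ×-dec P? false)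

module _ {A : Set} (∀? : {P : A → Set} → Decidable P → Dec (∀ x → P x)) where

  ∀-Vec? : ∀ {n} {P : Vec A n → Set} → Decidable P → Dec (∀ xs → P xs)
  ∀-Vec? {ℕ.zero}  P? = map′ (λ { p [] → p }) (λ p → p []) (P? [])
  ∀-Vec? {ℕ.suc n} P? = map′ (λ { p (x ∷ xs) → p x xs }) (λ p x xs → p (x ∷ xs))
                             (∀? λ x → ∀-Vec? (P? ∘ (x ∷_)))

∀-Subset? : ∀ {n} {P : Subset n → Set} → Decidable P → Dec (∀ s → P s)
∀-Subset? = ∀-Vec? ∀-Bool?

dec-true⁻¹ : ∀ {A : Set} (a? : Dec A) → does a? ≡ true → A
dec-true⁻¹ (yes a) _  = a
dec-true⁻¹ (no _)  ()

injective? : ∀ {m n} (f : Fin m → Fin n) → Dec (Injective _≡_ _≡_ f)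
injective? f = map′ (λ p {i} {j} → p i j) (λ p i j → p)
                    (all? λ i → all? λ j → (f i ≟ᶠ f j) →-dec (i ≟ᶠ j))

∈-allSubsets : ∀ {n} (s : Subset n) → s ∈ₗ allSubsets n
∈-allSubsets []                   = here refl
∈-allSubsets {ℕ.suc n} (true ∷ s)  = ∈-++⁺ˡ (∈-map⁺ (true ∷_) (∈-allSubsets s))
∈-allSubsets {ℕ.suc n} (false ∷ s) =
  ∈-++⁺ʳ (map (true ∷_) (allSubsets n)) (∈-map⁺ (false ∷_) (∈-allSubsets s))

punchOut-vec : ∀ {m n} {q : Fin (ℕ.suc n)} {v : Fin m → Fin (ℕ.suc n)} → (∀ i → v i ≢ q) →
  ∃ λ (t : Vec (Fin n) m) → v ≗ punchIn q ∘ lookup t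
punchOut-vec {m} {n} {q} {v} v≢q =
  tabulate w , λ i → trans (sym (punchIn-punchOut (v≢q i ∘ sym)))
                           (cong (punchIn q) (sym (lookup∘tabulate w i)))
  where
  w : Fin m → Fin n
  w i = punchOut (v≢q i ∘ sym)

∈-edge⁻ : ∀ {x a b} → x ∈ edge a b → x ≡ a ⊎ x ≡ b
∈-edge⁻ {a = a} {b} x∈ab with x∈p∪q⁻ ⁅ a ⁆ ⁅ b ⁆ x∈ab
... | inj₁ x∈a = inj₁ (x∈⁅y⁆⇒x≡y a x∈a)
... | inj₂ x∈b = inj₂ (x∈⁅y⁆⇒x≡y b x∈b)

∈-edgeˡ : ∀ a b → a ∈ edge a b
∈-edgeˡ a b = x∈p∪q⁺ (inj₁ (x∈⁅x⁆ a))

∈-edgeʳ : ∀ a b → b ∈ edge a b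
∈-edgeʳ a b = x∈p∪q⁺ (inj₂ (x∈⁅x⁆ b))

edge-comm : ∀ a b → edge a b ≡ edge b a
edge-comm a b = ∪-comm ⁅ a ⁆ ⁅ b ⁆

edge-injective : ∀ {a b c d} → a ≢ b → edge a b ≡ edge c d → (a ≡ c × b ≡ d) ⊎ (b ≡ c × a ≡ d)
edge-injective {a} {b} a≢b ab≡cd
  with ∈-edge⁻ (subst (a ∈_) ab≡cd (∈-edgeˡ a b)) | ∈-edge⁻ (subst (b ∈_) ab≡cd (∈-edgeʳ a b))
... | inj₁ a≡c | inj₂ b≡d = inj₁ (a≡c , b≡d)
... | inj₂ a≡d | inj₁ b≡c = inj₂ (b≡c , a≡d)
... | inj₁ a≡c | inj₁ b≡c = contradiction (trans a≡c (sym b≡c)) a≢b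
... | inj₂ a≡d | inj₂ b≡d = contradiction (trans a≡d (sym b≡d)) a≢b

-- Facts established by exhaustive evaluation are opaque: unfolding the proof terms built by
-- from-yes makes later unification problems explode.
opaque
  ∣s∣≡2⇒edge : ∀ (s : Subset 6) → ∣ s ∣ ≡ 2 → ∃₂ λ a b → a ≢ b × s ≡ edge a b
  ∣s∣≡2⇒edge = from-yes (∀-Subset? λ s → (∣ s ∣ ≟ℕ 2) →-dec
    any? λ a → any? λ b → ¬? (a ≟ᶠ b) ×-dec (s ≟ₛ edge a b))

EdgeAvoiding : Fin 6 → Subset 6 → Set
EdgeAvoiding q s = ∣ s ∣ ≡ 2 × q ∉ s

edgeAvoiding? : ∀ q s → Dec (EdgeAvoiding q s)
edgeAvoiding? q s = (∣ s ∣ ≟ℕ 2) ×-dec ¬? (q ∈? s)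

_≈[_]_ : (Subset 6 → Bool) → Fin 6 → (Subset 6 → Bool) → Set
W ≈[ q ] W′ = ∀ s → EdgeAvoiding q s → W s ≡ W′ s

opaque
  dT-edgeAvoiding : ∀ q T → ∣ T ∣ ≡ 3 → EdgeAvoiding q (dT q T)
  dT-edgeAvoiding = from-yes (all? λ q → ∀-Subset? λ T →
    (∣ T ∣ ≟ℕ 3) →-dec edgeAvoiding? q (dT q T))

firstSuch-cong : ∀ {p p′} → p ≗ p′ → ∀ ss → firstSuch p ss ≡ firstSuch p′ ss
firstSuch-cong p≗p′ []       = refl
firstSuch-cong {p′ = p′} p≗p′ (s ∷ ss) rewrite p≗p′ s =
  cong (if p′ s then s else_) (firstSuch-cong p≗p′ ss)

otherEdge-local : ∀ {q W W′ d} → W ≈[ q ] W′ → W d ≡ W′ d → otherEdge q W d ≡ otherEdge q W′ d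
otherEdge-local {q} {W} {W′} {d} W≈W′ Wd≡W′d = firstSuch-cong same-search-test (allSubsets 6)
  where
  same-search-test : ∀ s →
    ((∣ s ∣ ≡ᵇ 2) ∧ not (does (q ∈? s)) ∧ does (s ∩ d ≟ₛ ⊥) ∧ not (does (W s ≟ᵇ W d)))
      ≡ ((∣ s ∣ ≡ᵇ 2) ∧ not (does (q ∈? s)) ∧ does (s ∩ d ≟ₛ ⊥) ∧ not (does (W′ s ≟ᵇ W′ d)))
  same-search-test s with ∣ s ∣ ≡ᵇ 2 in |s|≡ᵇ2 | q ∈? s
  ... | false | _       = refl
  ... | true  | yes _   = refl
  ... | true  | no  q∉s
    rewrite W≈W′ s (≡ᵇ⇒≡ ∣ s ∣ 2 (from T-≡ |s|≡ᵇ2) , q∉s) | Wd≡W′d = refl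

ρ-local : ∀ {q W W′ T} → W ≈[ q ] W′ → ∣ T ∣ ≡ 3 → ρ q W T ≡ ρ q W′ T
ρ-local {q} {W} {W′} {T} W≈W′ |T|≡3 =
  cong₂ (λ c d′ → if does (c ≟ᵇ does (q ∈? T)) then ⁅ q ⁆ ∪ d′ else ∁ (⁅ q ⁆ ∪ d′))
        same-colour (otherEdge-local W≈W′ same-colour)
  where
  same-colour : W (dT q T) ≡ W′ (dT q T)
  same-colour = W≈W′ (dT q T) (dT-edgeAvoiding q T |T|≡3)

IsJ631≅J63 : (Subset 6 → Subset 6) → Set
IsJ631≅J63 f =
  (∀ T U → ∣ T ∣ ≡ 3 → ∣ U ∣ ≡ 3 → (∣ T ∩ U ∣ ≡ 1 ⇔ ∣ f T ∩ f U ∣ ≡ 2))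
  × (∀ T → ∣ T ∣ ≡ 3 → ∣ f T ∣ ≡ 3)
  × (∀ T U → ∣ T ∣ ≡ 3 → ∣ U ∣ ≡ 3 → f T ≡ f U → T ≡ U)

IsJ631≅J63-resp : ∀ {f g} → (∀ T → ∣ T ∣ ≡ 3 → f T ≡ g T) → IsJ631≅J63 g → IsJ631≅J63 f
IsJ631≅J63-resp f≡g (adjacency , size , injective) =
  (λ T U |T| |U| → subst₂ (λ fT fU → ∣ T ∩ U ∣ ≡ 1 ⇔ ∣ fT ∩ fU ∣ ≡ 2)
                          (sym (f≡g T |T|)) (sym (f≡g U |U|)) (adjacency T U |T| |U|))
  , (λ T |T| → subst (λ fT → ∣ fT ∣ ≡ 3) (sym (f≡g T |T|)) (size T |T|))
  , (λ T U |T| |U| fT≡fU →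
       injective T U |T| |U| (trans (sym (f≡g T |T|)) (trans fT≡fU (f≡g U |U|))))

triples : List (Subset 6)
triples = filter (λ s → ∣ s ∣ ≟ℕ 3) (allSubsets 6)

graph : (Subset 6 → Subset 6) → List (Subset 6 × Subset 6)
graph f = map < id , f > triples

Compatible : Subset 6 × Subset 6 → Subset 6 × Subset 6 → Set
Compatible (T , fT) (U , fU) = (∣ T ∩ U ∣ ≡ 1 ⇔ ∣ fT ∩ fU ∣ ≡ 2) × (fT ≡ fU → T ≡ U)

compatible? : ∀ x y → Dec (Compatible x y)
compatible? (T , fT) (U , fU) =
  ((∣ T ∩ U ∣ ≟ℕ 1) ⇔? (∣ fT ∩ fU ∣ ≟ℕ 2)) ×-dec ((fT ≟ₛ fU) →-dec (T ≟ₛ U))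

IsJ631≅J63-Graph : List (Subset 6 × Subset 6) → Set
IsJ631≅J63-Graph G = All (λ x → ∣ proj₂ x ∣ ≡ 3 × All (Compatible x) G) G

isJ631≅J63-Graph? : ∀ G → Dec (IsJ631≅J63-Graph G)
isJ631≅J63-Graph? G = All.all? (λ x → (∣ proj₂ x ∣ ≟ℕ 3) ×-dec All.all? (compatible? x) G) G

graph⇒IsJ631≅J63 : ∀ f → IsJ631≅J63-Graph (graph f) → IsJ631≅J63 f
graph⇒IsJ631≅J63 f good =
  (λ T U |T| |U| → proj₁ (compatible |T| |U|))
  , (λ T |T| → proj₁ (row |T|))
  , (λ T U |T| |U| → proj₂ (compatible |T| |U|))
  where
  ∈-graph : ∀ {T} → ∣ T ∣ ≡ 3 → (T , f T) ∈ₗ graph f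
  ∈-graph {T} |T| = ∈-map⁺ < id , f > (∈-filter⁺ (λ s → ∣ s ∣ ≟ℕ 3) (∈-allSubsets T) |T|)

  row : ∀ {T} → ∣ T ∣ ≡ 3 → ∣ f T ∣ ≡ 3 × All (Compatible (T , f T)) (graph f)
  row = All.lookup good ∘ ∈-graph

  compatible : ∀ {T U} → ∣ T ∣ ≡ 3 → ∣ U ∣ ≡ 3 → Compatible (T , f T) (U , f U)
  compatible |T| |U| = All.lookup (proj₂ (row |T|)) (∈-graph |U|)

Consecutive : (Fin 5 → Fin 6) → Fin 6 → Fin 6 → Set
Consecutive v a b = ∃ λ i → (a ≡ v i × b ≡ v (next5 i)) ⊎ (b ≡ v i × a ≡ v (next5 i))

cycleEdge : (Fin 5 → Fin 6) → Fin 5 → Subset 6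
cycleEdge v i = edge (v i) (v (next5 i))

cycleColouring : (Fin 5 → Fin 6) → Subset 6 → Bool
cycleColouring v s = does (any? λ i → s ≟ₛ cycleEdge v i)

cycleColouring-edge : ∀ {v a b} → a ≢ b → cycleColouring v (edge a b) ≡ true ⇔ Consecutive v a b
cycleColouring-edge {v} {a} {b} a≢b = mk⇔ consecutive white
  where
  consecutive : cycleColouring v (edge a b) ≡ true → Consecutive v a b
  consecutive ab-white =
    let i , ab≡i = dec-true⁻¹ (any? λ j → edge a b ≟ₛ cycleEdge v j) ab-white
    in  i , edge-injective a≢b ab≡i

  white : Consecutive v a b → cycleColouring v (edge a b) ≡ true
  white (i , inj₁ (refl , refl)) = dec-true (any? λ j → edge a b ≟ₛ cycleEdge v j) (i , refl)
  white (i , inj₂ (refl , refl)) = dec-true (any? λ j → edge a b ≟ₛ cycleEdge v j) (i , edge-comm a b)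

cycleColouring-sameEdges : ∀ {v w} (φ ψ : Fin 5 → Fin 5) →
  (∀ i → cycleEdge v i ≡ cycleEdge w (φ i)) → (∀ j → cycleEdge w j ≡ cycleEdge v (ψ j)) →
  cycleColouring v ≗ cycleColouring w
cycleColouring-sameEdges {v} {w} φ ψ vφ wψ s =
  does-⇔ (mk⇔ (λ (i , s≡i) → φ i , trans s≡i (vφ i)) (λ (j , s≡j) → ψ j , trans s≡j (wψ j)))
         (any? λ i → s ≟ₛ cycleEdge v i) (any? λ j → s ≟ₛ cycleEdge w j)

cycleColouring-cong : ∀ {v w} → v ≗ w → cycleColouring v ≗ cycleColouring w
cycleColouring-cong v≗w = cycleColouring-sameEdges id id
  (λ i → cong₂ edge (v≗w i) (v≗w (next5 i))) (λ j → sym (cong₂ edge (v≗w j) (v≗w (next5 j))))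

whiteCycle⇒≈ : ∀ {q W v} →
  (∀ a b → a ≢ q → b ≢ q → a ≢ b → (W (edge a b) ≡ true ⇔ Consecutive v a b)) →
  W ≈[ q ] cycleColouring v
whiteCycle⇒≈ {q} {W} {v} white s (|s| , q∉s) = same-colour (∣s∣≡2⇒edge s |s|)
  where
  same-colour : (∃₂ λ a b → a ≢ b × s ≡ edge a b) → W s ≡ cycleColouring v s
  same-colour (a , b , a≢b , refl) =
    ⇔→≡ (⇔-sym (cycleColouring-edge a≢b)
         ⇔-∘ white a b (avoid (∈-edgeˡ a b)) (avoid (∈-edgeʳ a b)) a≢b)
    where
    avoid : ∀ {x} → x ∈ edge a b → x ≢ q
    avoid x∈ab refl = q∉s x∈ab

prev5 : Fin 5 → Fin 5
prev5 zero                         = suc (suc (suc (suc zero)))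
prev5 (suc zero)                   = zero
prev5 (suc (suc zero))             = suc zero
prev5 (suc (suc (suc zero)))       = suc (suc zero)
prev5 (suc (suc (suc (suc zero)))) = suc (suc (suc zero))

mirror5 : Fin 5 → Fin 5
mirror5 zero                         = zero
mirror5 (suc zero)                   = suc (suc (suc (suc zero)))
mirror5 (suc (suc zero))             = suc (suc (suc zero))
mirror5 (suc (suc (suc zero)))       = suc (suc zero)
mirror5 (suc (suc (suc (suc zero)))) = suc zero

opaque
  next5-prev5 : ∀ i → next5 (prev5 i) ≡ i
  next5-prev5 = from-yes (all? λ i → next5 (prev5 i) ≟ᶠ i)

opaque
  mirror5∘next5-involutive : ∀ i → mirror5 (next5 (mirror5 (next5 i))) ≡ i
  mirror5∘next5-involutive = from-yes (all? λ i → mirror5 (next5 (mirror5 (next5 i))) ≟ᶠ i)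

opaque
  next5-mirror5-next5 : ∀ i → next5 (mirror5 (next5 i)) ≡ mirror5 i
  next5-mirror5-next5 = from-yes (all? λ i → next5 (mirror5 (next5 i)) ≟ᶠ mirror5 i)

Symmetry : (Fin 5 → Fin 5) → Set
Symmetry σ = ∀ v → cycleColouring (v ∘ σ) ≗ cycleColouring v

next5-symmetry : Symmetry next5
next5-symmetry v = cycleColouring-sameEdges next5 prev5
  (λ i → refl) (λ j → cong (cycleEdge v) (sym (next5-prev5 j)))

mirror5-symmetry : Symmetry mirror5
mirror5-symmetry v = cycleColouring-sameEdges (mirror5 ∘ next5) (mirror5 ∘ next5) reflected reflected⁻¹
  where
  open ≡-Reasoning

  reflected : ∀ i → cycleEdge (v ∘ mirror5) i ≡ cycleEdge v (mirror5 (next5 i))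
  reflected i = begin
    edge (v (mirror5 i)) (v (mirror5 (next5 i)))
      ≡⟨ edge-comm _ _ ⟩
    edge (v (mirror5 (next5 i))) (v (mirror5 i))
      ≡⟨ cong (edge (v (mirror5 (next5 i))) ∘ v) (next5-mirror5-next5 i) ⟨
    edge (v (mirror5 (next5 i))) (v (next5 (mirror5 (next5 i))))
      ∎

  reflected⁻¹ : ∀ j → cycleEdge v j ≡ cycleEdge (v ∘ mirror5) (mirror5 (next5 j))
  reflected⁻¹ j = trans (cong (cycleEdge v) (sym (mirror5∘next5-involutive j)))
                        (sym (reflected (mirror5 (next5 j))))

symmetry-∘ : ∀ {σ τ} → Symmetry σ → Symmetry τ → Symmetry (σ ∘ τ)
symmetry-∘ {σ} σ-symmetry τ-symmetry v s = trans (τ-symmetry (v ∘ σ) s) (σ-symmetry v s)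

dihedral5 : List (∃ Symmetry)
dihedral5 = rotations ++ map reflect rotations
  where
  reflect : ∃ Symmetry → ∃ Symmetry
  reflect (σ , σ-symmetry) = mirror5 ∘ σ , symmetry-∘ {mirror5} {σ} mirror5-symmetry σ-symmetry

  rotations : List (∃ Symmetry)
  rotations = iterate rotate (id , λ _ _ → refl) 5
    where
    rotate : ∃ Symmetry → ∃ Symmetry
    rotate (σ , σ-symmetry) = σ ∘ next5 , symmetry-∘ {σ} {next5} σ-symmetry next5-symmetry

permute : ∀ {A : Set} → (Fin 5 → Fin 5) → Vec A 5 → Vec A 5
permute σ t = tabulate (lookup t ∘ σ)

cycleAvoiding : Fin 6 → Vec (Fin 5) 5 → Fin 5 → Fin 6
cycleAvoiding q t = punchIn q ∘ lookup t

-- One representative of each dihedral orbit of cyclic orderings of Fin 5.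
Canonical : (Fin 5 → Fin 5) → Set
Canonical w = (w zero ≡ zero × w (# 1) < w (# 4)) × Injective _≡_ _≡_ w

canonical? : ∀ w → Dec (Canonical w)
canonical? w = ((w zero ≟ᶠ zero) ×-dec (w (# 1) <? w (# 4))) ×-dec injective? w

opaque
  canonical-image : ∀ (t : Vec (Fin 5) 5) → Injective _≡_ _≡_ (lookup t) →
    Any (λ (σ , _) → Canonical (lookup (permute σ t))) dihedral5
  canonical-image = from-yes (∀-Vec? all? λ t → injective? (lookup t) →-dec
    Any.any? (λ (σ , _) → canonical? (lookup (permute σ t))) dihedral5)

opaque
  canonical⇒IsJ631≅J63-Graph : ∀ (t : Vec (Fin 5) 5) → Canonical (lookup t) →
    ∀ q → IsJ631≅J63-Graph (graph (ρ q (cycleColouring (cycleAvoiding q t))))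
  canonical⇒IsJ631≅J63-Graph = from-yes (∀-Vec? all? λ t → canonical? (lookup t) →-dec
    all? λ q → isJ631≅J63-Graph? (graph (ρ q (cycleColouring (cycleAvoiding q t)))))

cycle⇒IsJ631≅J63 : ∀ q (t : Vec (Fin 5) 5) → Injective _≡_ _≡_ (lookup t) →
  IsJ631≅J63 (ρ q (cycleColouring (cycleAvoiding q t)))
cycle⇒IsJ631≅J63 q t t-injective = via-symmetry (Any.satisfied (canonical-image t t-injective))
  where
  via-symmetry : (∃ λ ((σ , _) : ∃ Symmetry) → Canonical (lookup (permute σ t))) →
    IsJ631≅J63 (ρ q (cycleColouring (cycleAvoiding q t)))
  via-symmetry ((σ , σ-symmetry) , canonical) =
    IsJ631≅J63-resp {ρ q W} {ρ q W′}
      (λ T |T| → ρ-local {q} {W} {W′} {T} (λ s _ → same-colouring s) |T|)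
      (graph⇒IsJ631≅J63 (ρ q (cycleColouring (cycleAvoiding q (permute σ t))))
                        (canonical⇒IsJ631≅J63-Graph (permute σ t) canonical q))
    where
    W W′ : Subset 6 → Bool
    W  = cycleColouring (cycleAvoiding q t)
    W′ = cycleColouring (cycleAvoiding q (permute σ t))
    same-colouring : W ≗ W′
    same-colouring s = trans (sym (σ-symmetry (cycleAvoiding q t) s))
      (cycleColouring-cong (cong (punchIn q) ∘ sym ∘ lookup∘tabulate (lookup t ∘ σ)) s)

mainTheorem13 : (q : Fin 6) (W : Subset 6 → Bool) →
    ColourClassIs5Cycle q W true →
    ColourClassIs5Cycle q W false →
    (∀ T U → ∣ T ∣ ≡ 3 → ∣ U ∣ ≡ 3 →
      (∣ T ∩ U ∣ ≡ 1 ⇔ ∣ ρ q W T ∩ ρ q W U ∣ ≡ 2))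
    × (∀ T → ∣ T ∣ ≡ 3 → ∣ ρ q W T ∣ ≡ 3)
    × (∀ T U → ∣ T ∣ ≡ 3 → ∣ U ∣ ≡ 3 → ρ q W T ≡ ρ q W U → T ≡ U)
-- The black class is the complement of the white 5-cycle in K₅.
mainTheorem13 q W (v , v-injective , v≢q , white) _ = via-vector (punchOut-vec v≢q)
  where
  via-vector : (∃ λ t → v ≗ cycleAvoiding q t) → IsJ631≅J63 (ρ q W)
  via-vector (t , v≗t) =
    IsJ631≅J63-resp {ρ q W} {ρ q W′} (λ T |T| → ρ-local {q} {W} {W′} {T} W≈W′ |T|)
      (cycle⇒IsJ631≅J63 q t λ {i} {j} ti≡tj →
        v-injective (trans (v≗t i) (trans (cong (punchIn q) ti≡tj) (sym (v≗t j)))))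
    where
    W′ : Subset 6 → Bool
    W′ = cycleColouring (cycleAvoiding q t)
    W≈W′ : W ≈[ q ] W′
    W≈W′ s s-edge = trans (whiteCycle⇒≈ white s s-edge) (cycleColouring-cong v≗t s)
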